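{- Let $P$ and $Q$ be upper primes. Then $PQ-QP$ lies in the two-sided ideal of $\mathcal{A}$ generated by $\{U(LR)-(LR)U\colon U \text{ an upper prime}\}$.
   Context: Let $\mathcal{A}$ be the free associative $\mathbb{C}$-algebra on two generators $L$ and $R$ (letters). A word is a finite product of letters. A word is balanced if $L$ and $R$ occur in it equally many times. A word is prime if it is nonempty, balanced, and not a product of two nonempty balanced words. For a word $W=a_1\cdots a_n$ and $0\le k\le n$, $e_k(W)=\sum_{i=1}^k\overline{a_i}$ with $\overline{R}=1$, $\overline{L}=-1$. A prime $P$ of length $l(P)$ is an upper prime if $e_k(P)>0$ for $1\le k\le l(P)-1$. -}

module Defs where

open import Data.Nat using (ℕ; zero; suc; _≤_; _∸_)
open import Data.Integer as ℤ using (ℤ; +_; -[1+_])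
open import Data.Rational as ℚ using (ℚ; 0ℚ; 1ℚ)
open import Data.List using (List; []; _∷_; _++_; length; take; filter; map; concatMap; foldr)
open import Data.List.Properties using (≡-dec)
open import Data.Product using (Σ; ∃; _×_; _,_)
open import Relation.Nullary using (¬_; Dec; yes; no)
open import Relation.Binary.PropositionalEquality using (_≡_; _≢_; refl)

data Letter : Set where
  L R : Letter

Word : Set
Word = List Letter

_≟ᴸ_ : (a b : Letter) → Dec (a ≡ b)
L ≟ᴸ L = yes refl
L ≟ᴸ R = no λ ()
R ≟ᴸ L = no λ ()
R ≟ᴸ R = yes refl

_≟ᵂ_ : (u v : Word) → Dec (u ≡ v)
_≟ᵂ_ = ≡-dec _≟ᴸ_

count : Letter → Word → ℕ
count a [] = 0
count a (b ∷ w) with a ≟ᴸ b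
... | yes _ = suc (count a w)
... | no  _ = count a w

Balanced : Word → Set
Balanced w = count L w ≡ count R w

Prime : Word → Set
Prime P = P ≢ [] × Balanced P ×
  ¬ (Σ Word λ U → Σ Word λ V →
       U ≢ [] × V ≢ [] × Balanced U × Balanced V × P ≡ U ++ V)

bar : Letter → ℤ
bar R = + 1
bar L = -[1+ 0 ]

e : ℕ → Word → ℤ
e k W = foldr (λ a s → bar a ℤ.+ s) (+ 0) (take k W)

UpperPrime : Word → Set
UpperPrime P = Prime P × (∀ k → 1 ≤ k → k ≤ length P ∸ 1 → + 0 ℤ.< e k P)

-- Elements of the free associative algebra over ℚ on {L,R}:
-- finite formal linear combinations of words; two lists denote the
-- same element iff all coefficients agree.
Poly : Set
Poly = List (ℚ × Word)

coeff : Poly → Word → ℚ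
coeff [] w = 0ℚ
coeff ((c , u) ∷ p) w with u ≟ᵂ w
... | yes _ = c ℚ.+ coeff p w
... | no  _ = coeff p w

_≈ᴾ_ : Poly → Poly → Set
p ≈ᴾ q = ∀ w → coeff p w ≡ coeff q w

sandwich : ℚ → Word → Poly → Word → Poly
sandwich c A p B = map (λ { (d , u) → (c ℚ.* d , A ++ u ++ B) }) p

comm : Word → Word → Poly
comm X Y = (1ℚ , X ++ Y) ∷ (ℚ.- 1ℚ , Y ++ X) ∷ []

LR : Word
LR = L ∷ R ∷ []

-- a term c · A · (U(LR) - (LR)U) · B with U an upper prime
IdealTerm : Set
IdealTerm = ℚ × Word × (Σ Word UpperPrime) × Word

evalTerms : List IdealTerm → Poly
evalTerms = concatMap (λ { (c , A , (U , _) , B) → sandwich c A (comm U LR) B })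

InIdeal : Poly → Set
InIdeal p = Σ (List IdealTerm) λ ts → p ≈ᴾ evalTerms ts

-- Write v ≈ w when v − w lies in the ideal. An upper prime is exactly a word R d L with d a
-- Dyck word (a word whose height profile starts and ends at 0 and never goes negative), and a
-- Dyck word is a product of upper primes. Hence d (LR) ≈ (LR) d for every Dyck word d, and so
--   (R d L)(R f L) = R d (LR) f L ≈ R (LR) d f L   and   (R f L)(R d L) ≈ R (LR) f d L.
-- The two right-hand sides agree modulo ≈ as soon as d f ≈ f d, which holds by induction on the
-- size of Dyck words: d and f are products of shorter upper primes, which commute pairwise.

module Submission where

open import Defs
open import Data.List using (List; []; _∷_; _++_; length; map; _∷ʳ_; _∷ʳ′_; initLast)
open import Data.List.Properties
  using (++-assoc; ++-identityʳ; map-++; length-++-≤ˡ; length-++-sucʳ)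
open import Data.Nat as ℕ using (ℕ; zero; suc; _≤_; _∸_; z≤n; s≤s; s≤s⁻¹)
import Data.Nat.Properties as ℕP
open import Data.Integer as ℤ using (+_; -[1+_]; 0ℤ; _⊖_)
import Data.Integer.Properties as ℤP
open import Data.Rational as ℚ using (ℚ; 0ℚ; 1ℚ)
import Data.Rational.Properties as ℚP
open import Data.Product as Product using (Σ; _×_; _,_)
open import Data.Empty using (⊥-elim)
open import Relation.Nullary using (¬_; yes; no)
open import Relation.Binary.Bundles using (Setoid)
open import Relation.Binary.PropositionalEquality
open import Algebra.Bundles using (CommutativeMonoid)
open import Algebra.Properties.CommutativeSemigroup
  (CommutativeMonoid.commutativeSemigroup ℚP.+-0-commutativeMonoid) using (x∙yz≈y∙xz)
open import Algebra.Properties.Group ℚP.+-0-group using (\\-leftDividesˡ)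

variable
  A B C U V d f D E w : Word
  p q r : Poly
  h h′ h″ : ℕ
  b : Letter

-- A syntactic equivalence of formal sums. It is sound for ≈ᴾ and, unlike ≈ᴾ, evidently
-- preserved by relabelling the words of a sum with an arbitrary (non-injective) function.
infix 4 _∼_
data _∼_ : Poly → Poly → Set where
  ∼-refl   : p ∼ p
  ∼-sym    : p ∼ q → q ∼ p
  ∼-trans  : p ∼ q → q ∼ r → p ∼ r
  ∼-cons   : ∀ t → p ∼ q → t ∷ p ∼ t ∷ q
  ∼-swap   : ∀ s t p → s ∷ t ∷ p ∼ t ∷ s ∷ p
  ∼-cancel : ∀ c u p → (c , u) ∷ (ℚ.- c , u) ∷ p ∼ p

term-coeff : ℚ → Word → Word → ℚ
term-coeff c u w with u ≟ᵂ w
... | yes _ = c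
... | no _ = 0ℚ

coeff-∷ : ∀ c u p w → coeff ((c , u) ∷ p) w ≡ term-coeff c u w ℚ.+ coeff p w
coeff-∷ c u p w with u ≟ᵂ w
... | yes _ = refl
... | no _ = sym (ℚP.+-identityˡ (coeff p w))

term-coeff-neg : ∀ c u w → term-coeff (ℚ.- c) u w ≡ ℚ.- term-coeff c u w
term-coeff-neg c u w with u ≟ᵂ w
... | yes _ = refl
... | no _ = refl

∼⇒≈ᴾ : p ∼ q → p ≈ᴾ q
∼⇒≈ᴾ ∼-refl w = refl
∼⇒≈ᴾ (∼-sym r) w = sym (∼⇒≈ᴾ r w)
∼⇒≈ᴾ (∼-trans r s) w = trans (∼⇒≈ᴾ r w) (∼⇒≈ᴾ s w)
∼⇒≈ᴾ (∼-cons {p} {q} (c , u) r) w = begin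
  coeff ((c , u) ∷ p) w       ≡⟨ coeff-∷ c u p w ⟩
  term-coeff c u w ℚ.+ coeff p w  ≡⟨ cong (term-coeff c u w ℚ.+_) (∼⇒≈ᴾ r w) ⟩
  term-coeff c u w ℚ.+ coeff q w  ≡⟨ coeff-∷ c u q w ⟨
  coeff ((c , u) ∷ q) w       ∎
  where open ≡-Reasoning
∼⇒≈ᴾ (∼-swap (c , u) (c′ , u′) p) w = begin
  coeff ((c , u) ∷ (c′ , u′) ∷ p) w  ≡⟨ coeff-∷ c u _ w ⟩
  t ℚ.+ coeff ((c′ , u′) ∷ p) w      ≡⟨ cong (t ℚ.+_) (coeff-∷ c′ u′ p w) ⟩
  t ℚ.+ (t′ ℚ.+ coeff p w)           ≡⟨ x∙yz≈y∙xz t t′ (coeff p w) ⟩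
  t′ ℚ.+ (t ℚ.+ coeff p w)           ≡⟨ cong (t′ ℚ.+_) (coeff-∷ c u p w) ⟨
  t′ ℚ.+ coeff ((c , u) ∷ p) w       ≡⟨ coeff-∷ c′ u′ _ w ⟨
  coeff ((c′ , u′) ∷ (c , u) ∷ p) w  ∎
  where
  open ≡-Reasoning
  t = term-coeff c u w
  t′ = term-coeff c′ u′ w
∼⇒≈ᴾ (∼-cancel c u p) w = begin
  coeff ((c , u) ∷ (ℚ.- c , u) ∷ p) w  ≡⟨ coeff-∷ c u _ w ⟩
  t ℚ.+ coeff ((ℚ.- c , u) ∷ p) w      ≡⟨ cong (t ℚ.+_) (coeff-∷ (ℚ.- c) u p w) ⟩
  t ℚ.+ (t⁻ ℚ.+ coeff p w)             ≡⟨ cong (λ s → t ℚ.+ (s ℚ.+ coeff p w)) (term-coeff-neg c u w) ⟩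
  t ℚ.+ (ℚ.- t ℚ.+ coeff p w)          ≡⟨ \\-leftDividesˡ t (coeff p w) ⟩
  coeff p w                            ∎
  where
  open ≡-Reasoning
  t = term-coeff c u w
  t⁻ = term-coeff (ℚ.- c) u w

∼-++ : p ∼ q → ∀ r → p ++ r ∼ q ++ r
∼-++ ∼-refl r = ∼-refl
∼-++ (∼-sym s) r = ∼-sym (∼-++ s r)
∼-++ (∼-trans s t) r = ∼-trans (∼-++ s r) (∼-++ t r)
∼-++ (∼-cons t s) r = ∼-cons t (∼-++ s r)
∼-++ (∼-swap s t p) r = ∼-swap s t (p ++ r)
∼-++ (∼-cancel c u p) r = ∼-cancel c u (p ++ r)

++-∼ : ∀ r → p ∼ q → r ++ p ∼ r ++ q
++-∼ [] s = s
++-∼ (t ∷ r) s = ∼-cons t (++-∼ r s)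

∼-map : (φ : ℚ → ℚ) (ψ : Word → Word) → (∀ c → φ (ℚ.- c) ≡ ℚ.- φ c) →
        p ∼ q → map (Product.map φ ψ) p ∼ map (Product.map φ ψ) q
∼-map φ ψ odd ∼-refl = ∼-refl
∼-map φ ψ odd (∼-sym s) = ∼-sym (∼-map φ ψ odd s)
∼-map φ ψ odd (∼-trans s t) = ∼-trans (∼-map φ ψ odd s) (∼-map φ ψ odd t)
∼-map φ ψ odd (∼-cons t s) = ∼-cons _ (∼-map φ ψ odd s)
∼-map φ ψ odd (∼-swap s t p) = ∼-swap _ _ _
∼-map φ ψ odd (∼-cancel c u p) =
  subst (λ c′ → (φ c , ψ u) ∷ (c′ , ψ u) ∷ p′ ∼ p′) (sym (odd c))
    (∼-cancel (φ c) (ψ u) p′)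
  where p′ = map (Product.map φ ψ) p

negate : Poly → Poly
negate = map (Product.map ℚ.-_ (λ u → u))

sandwich¹ : Word → Poly → Word → Poly
sandwich¹ X p Y = map (Product.map (λ c → c) (λ u → X ++ u ++ Y)) p

Ideal : Poly → Set
Ideal p = Σ (List IdealTerm) λ ts → p ∼ evalTerms ts

Ideal-∼ : p ∼ q → Ideal q → Ideal p
Ideal-∼ s (ts , t) = ts , ∼-trans s t

evalTerms-++ : ∀ ts us → evalTerms (ts ++ us) ≡ evalTerms ts ++ evalTerms us
evalTerms-++ [] us = refl
evalTerms-++ ((c , A , (U , _) , B) ∷ ts) us =
  trans (cong (sandwich c A (comm U LR) B ++_) (evalTerms-++ ts us))
        (sym (++-assoc (sandwich c A (comm U LR) B) (evalTerms ts) (evalTerms us)))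

Ideal-++ : Ideal p → Ideal q → Ideal (p ++ q)
Ideal-++ {q = q} (ts , s) (us , t) =
  ts ++ us ,
  subst (_ ∼_) (sym (evalTerms-++ ts us)) (∼-trans (∼-++ s q) (++-∼ (evalTerms ts) t))

negate-evalTerms : ∀ ts →
  evalTerms (map (Product.map ℚ.-_ (λ t → t)) ts) ≡ negate (evalTerms ts)
negate-evalTerms [] = refl
negate-evalTerms ((c , A , (U , _) , B) ∷ ts) =
  trans (cong₂ _++_ negate-term (negate-evalTerms ts))
        (sym (map-++ _ (sandwich c A (comm U LR) B) (evalTerms ts)))
  where
  negate-term : sandwich (ℚ.- c) A (comm U LR) B ≡ negate (sandwich c A (comm U LR) B)
  negate-term = cong₂ (λ a b → (a , A ++ (U ++ LR) ++ B) ∷ (b , A ++ (LR ++ U) ++ B) ∷ [])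
    (sym (ℚP.neg-distribˡ-* c 1ℚ)) (sym (ℚP.neg-distribˡ-* c (ℚ.- 1ℚ)))

Ideal-negate : Ideal p → Ideal (negate p)
Ideal-negate (ts , s) =
  map (Product.map ℚ.-_ (λ t → t)) ts ,
  subst (_ ∼_) (sym (negate-evalTerms ts)) (∼-map ℚ.-_ (λ u → u) (λ _ → refl) s)

sandwich¹-evalTerms : ∀ X Y ts →
  evalTerms (map (λ { (c , A , U , B) → (c , X ++ A , U , B ++ Y) }) ts) ≡
  sandwich¹ X (evalTerms ts) Y
sandwich¹-evalTerms X Y [] = refl
sandwich¹-evalTerms X Y ((c , A , (U , _) , B) ∷ ts) =
  trans (cong₂ _++_ sandwich-term (sandwich¹-evalTerms X Y ts))
        (sym (map-++ _ (sandwich c A (comm U LR) B) (evalTerms ts)))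
  where
  reassoc : ∀ u → (X ++ A) ++ u ++ (B ++ Y) ≡ X ++ (A ++ u ++ B) ++ Y
  reassoc u = trans (++-assoc X A _)
    (cong (X ++_) (sym (trans (++-assoc A (u ++ B) Y) (cong (A ++_) (++-assoc u B Y)))))
  sandwich-term : sandwich c (X ++ A) (comm U LR) (B ++ Y) ≡
                  sandwich¹ X (sandwich c A (comm U LR) B) Y
  sandwich-term = cong₂ (λ a b → (c ℚ.* 1ℚ , a) ∷ (c ℚ.* (ℚ.- 1ℚ) , b) ∷ [])
    (reassoc (U ++ LR)) (reassoc (LR ++ U))

Ideal-sandwich¹ : ∀ X Y → Ideal p → Ideal (sandwich¹ X p Y)
Ideal-sandwich¹ X Y (ts , s) =
  map (λ { (c , A , U , B) → (c , X ++ A , U , B ++ Y) }) ts ,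
  subst (_ ∼_) (sym (sandwich¹-evalTerms X Y ts))
    (∼-map (λ c → c) (λ u → X ++ u ++ Y) (λ _ → refl) s)

diff : Word → Word → Poly
diff A B = (1ℚ , A) ∷ (ℚ.- 1ℚ , B) ∷ []

infix 4 _≈ᴵ_
_≈ᴵ_ : Word → Word → Set
A ≈ᴵ B = Ideal (diff A B)

≈ᴵ-refl : A ≈ᴵ A
≈ᴵ-refl {A} = [] , ∼-cancel 1ℚ A []

-- ≈ᴵ-sym and ≈ᴵ-trans rely on ℚ.- (ℚ.- 1ℚ) computing to 1ℚ.
≈ᴵ-sym : A ≈ᴵ B → B ≈ᴵ A
≈ᴵ-sym A≈B = Ideal-∼ (∼-swap _ _ []) (Ideal-negate A≈B)

≈ᴵ-trans : A ≈ᴵ B → B ≈ᴵ C → A ≈ᴵ C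
≈ᴵ-trans {A} {B} {C} A≈B B≈C =
  Ideal-∼ (∼-cons (1ℚ , A) (∼-sym (∼-cancel (ℚ.- 1ℚ) B ((ℚ.- 1ℚ , C) ∷ []))))
    (Ideal-++ A≈B B≈C)

≈ᴵ-setoid : Setoid _ _
≈ᴵ-setoid = record
  { Carrier = Word
  ; _≈_ = _≈ᴵ_
  ; isEquivalence = record { refl = ≈ᴵ-refl ; sym = ≈ᴵ-sym ; trans = ≈ᴵ-trans }
  }

open import Relation.Binary.Reasoning.Setoid ≈ᴵ-setoid

≈ᴵ-cong : ∀ X Y → A ≈ᴵ B → X ++ A ++ Y ≈ᴵ X ++ B ++ Y
≈ᴵ-cong X Y = Ideal-sandwich¹ X Y

≈ᴵ-congˡ : ∀ X → A ≈ᴵ B → X ++ A ≈ᴵ X ++ B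
≈ᴵ-congˡ {A} {B} X A≈B =
  subst₂ (λ A′ B′ → X ++ A′ ≈ᴵ X ++ B′) (++-identityʳ A) (++-identityʳ B)
    (≈ᴵ-cong X [] A≈B)

≈ᴵ-congʳ : ∀ Y → A ≈ᴵ B → A ++ Y ≈ᴵ B ++ Y
≈ᴵ-congʳ = ≈ᴵ-cong []

Commutes : Word → Word → Set
Commutes A B = A ++ B ≈ᴵ B ++ A

commutes-[] : ∀ A → Commutes [] A
commutes-[] A = begin
  A        ≡⟨ ++-identityʳ A ⟨
  A ++ []  ∎

commutes-++ˡ : Commutes A C → Commutes B C → Commutes (A ++ B) C
commutes-++ˡ {A} {C} {B} AC BC = begin
  (A ++ B) ++ C  ≡⟨ ++-assoc A B C ⟩
  A ++ (B ++ C)  ≈⟨ ≈ᴵ-congˡ A BC ⟩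
  A ++ (C ++ B)  ≡⟨ ++-assoc A C B ⟨
  (A ++ C) ++ B  ≈⟨ ≈ᴵ-congʳ B AC ⟩
  (C ++ A) ++ B  ≡⟨ ++-assoc C A B ⟩
  C ++ (A ++ B)  ∎

commutes-++ʳ : Commutes A B → Commutes A C → Commutes A (B ++ C)
commutes-++ʳ {A} {B} {C} AB AC = begin
  A ++ (B ++ C)  ≡⟨ ++-assoc A B C ⟨
  (A ++ B) ++ C  ≈⟨ ≈ᴵ-congʳ C AB ⟩
  (B ++ A) ++ C  ≡⟨ ++-assoc B A C ⟩
  B ++ (A ++ C)  ≈⟨ ≈ᴵ-congˡ B AC ⟩
  B ++ (C ++ A)  ≡⟨ ++-assoc B C A ⟨
  (B ++ C) ++ A  ∎

upperPrime-commutes-LR : UpperPrime U → Commutes U LR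
upperPrime-commutes-LR {U} uU =
  ((1ℚ , [] , (U , uU) , []) ∷ []) ,
  subst₂ (λ a b → diff (U ++ LR) (LR ++ U) ∼ (1ℚ , a) ∷ (ℚ.- 1ℚ , b) ∷ [])
    (sym (++-identityʳ (U ++ LR))) (sym (++-identityʳ (LR ++ U))) ∼-refl

-- Prefix sums and height profiles

PositivePrefixes : Word → Set
PositivePrefixes P = ∀ k → 1 ≤ k → k ≤ length P ∸ 1 → 0ℤ ℤ.< e k P

e-++ : ∀ {k} xs ys → k ≤ length xs → e k (xs ++ ys) ≡ e k xs
e-++ {zero} xs ys k≤ = refl
e-++ {suc k} (x ∷ xs) ys (s≤s k≤) = cong (ℤ._+_ (bar x)) (e-++ xs ys k≤)

e-length : ∀ w → e (length w) w ≡ count R w ⊖ count L w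
e-length [] = refl
e-length (R ∷ w) =
  trans (cong (ℤ._+_ (+ 1)) (e-length w)) (ℤP.distribʳ-⊖-+-pos 1 (count R w) (count L w))
e-length (L ∷ w) =
  trans (cong (ℤ._+_ -[1+ 0 ]) (e-length w)) (ℤP.distribʳ-⊖-+-neg 0 (count R w) (count L w))

balanced⇒e-length≡0 : Balanced w → e (length w) w ≡ 0ℤ
balanced⇒e-length≡0 {w} bal =
  trans (e-length w) (trans (cong (count R w ⊖_) bal) (ℤP.n⊖n≡0 (count R w)))

positivePrefixes⇒¬balanced-prefix :
  PositivePrefixes (U ++ V) → U ≢ [] → V ≢ [] → ¬ Balanced U
positivePrefixes⇒¬balanced-prefix {[]} pos U≢[] _ _ = U≢[] refl
positivePrefixes⇒¬balanced-prefix {_ ∷ U} {[]} pos _ V≢[] _ = V≢[] refl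
positivePrefixes⇒¬balanced-prefix {u ∷ U} {v ∷ V} pos _ _ bal =
  ℤP.<-irrefl
    (sym (trans (e-++ (u ∷ U) (v ∷ V) ℕP.≤-refl) (balanced⇒e-length≡0 {u ∷ U} bal)))
    (pos (suc (length U)) (s≤s z≤n) |U|<|U++V|)
  where
  |U|<|U++V| : suc (length U) ≤ length (U ++ v ∷ V)
  |U|<|U++V| = subst (suc (length U) ≤_) (sym (length-++-sucʳ U v V)) (s≤s (length-++-≤ˡ U))

upperPrime : ∀ {P} → P ≢ [] → Balanced P → PositivePrefixes P → UpperPrime P
upperPrime P≢[] bal pos =
  (P≢[] , bal , λ (U , V , U≢[] , V≢[] , balU , _ , P≡UV) →
     positivePrefixes⇒¬balanced-prefix (subst PositivePrefixes P≡UV pos) U≢[] V≢[] balU) ,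
  pos

-- Path h w h′: reading w from height h, with R one step up and L one step down, never goes
-- below height 0 and ends at height h′.
data Path : ℕ → Word → ℕ → Set where
  nil  : Path h [] h
  up   : Path (suc h) w h′ → Path h (R ∷ w) h′
  down : Path h w h′ → Path (suc h) (L ∷ w) h′

path-++ : Path h A h′ → Path h′ B h″ → Path h (A ++ B) h″
path-++ nil q = q
path-++ (up p) q = up (path-++ p q)
path-++ (down p) q = down (path-++ p q)

path-lift : Path h w h′ → Path (suc h) w (suc h′)
path-lift nil = nil
path-lift (up p) = up (path-lift p)
path-lift (down p) = down (path-lift p)

path-R⟨⟩L : Path 0 w h → Path 0 (R ∷ w ++ L ∷ []) h
path-R⟨⟩L p = up (path-++ (path-lift p) (down nil))

path-count : Path h w h′ → count R w ℕ.+ h ≡ count L w ℕ.+ h′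
path-count nil = refl
path-count {h} (up {w = w} p) = trans (sym (ℕP.+-suc (count R w) h)) (path-count p)
path-count (down {h = h} {w = w} p) = trans (ℕP.+-suc (count R w) h) (cong suc (path-count p))

path-balanced : Path h w h′ → Balanced w → h ≡ h′
path-balanced {h} {w} {h′} p bal = 
  ℕP.+-cancelˡ-≡ (count R w) h h′ (trans (path-count p) (cong (ℕ._+ h′) bal))

closed-path⇒balanced : Path h w h → Balanced w
closed-path⇒balanced {h} {w} p =
  sym (ℕP.+-cancelʳ-≡ h (count R w) (count L w) (path-count p))

+h+[1+x]≡+[1+h]+x : ∀ h x → + h ℤ.+ (+ 1 ℤ.+ x) ≡ + suc h ℤ.+ x
+h+[1+x]≡+[1+h]+x h x =
  trans (sym (ℤP.+-assoc (+ h) (+ 1) x)) (cong (λ n → + n ℤ.+ x) (ℕP.+-comm h 1))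

+[1+h]+[-1+x]≡+h+x : ∀ h x → + suc h ℤ.+ (-[1+ 0 ] ℤ.+ x) ≡ + h ℤ.+ x
+[1+h]+[-1+x]≡+h+x h x = sym (ℤP.+-assoc (+ suc h) -[1+ 0 ] x)

path⇒e-nonneg : Path h w h′ → ∀ k → 0ℤ ℤ.≤ + h ℤ.+ e k w
path⇒e-nonneg p zero = ℤ.+≤+ z≤n
path⇒e-nonneg nil (suc k) = ℤ.+≤+ z≤n
path⇒e-nonneg {h} (up {w = w} p) (suc k) =
  subst (0ℤ ℤ.≤_) (sym (+h+[1+x]≡+[1+h]+x h (e k w))) (path⇒e-nonneg p k)
path⇒e-nonneg (down {h = h} {w = w} p) (suc k) =
  subst (0ℤ ℤ.≤_) (sym (+[1+h]+[-1+x]≡+h+x h (e k w))) (path⇒e-nonneg p k)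

e-nonneg⇒path : ∀ w h → (∀ k → k ≤ length w → 0ℤ ℤ.≤ + h ℤ.+ e k w) →
                Σ ℕ (Path h w)
e-nonneg⇒path [] h nonneg = h , nil
e-nonneg⇒path (R ∷ w) h nonneg =
  Product.map₂ up (e-nonneg⇒path w (suc h) λ k k≤ →
    subst (0ℤ ℤ.≤_) (+h+[1+x]≡+[1+h]+x h (e k w)) (nonneg (suc k) (s≤s k≤)))
e-nonneg⇒path (L ∷ w) zero nonneg with nonneg 1 (s≤s z≤n)
... | ()
e-nonneg⇒path (L ∷ w) (suc h) nonneg =
  Product.map₂ down (e-nonneg⇒path w h λ k k≤ →
    subst (0ℤ ℤ.≤_) (+[1+h]+[-1+x]≡+h+x h (e k w)) (nonneg (suc k) (s≤s k≤)))

-- Dyck words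

R⟨_⟩L : Word → Word
R⟨ d ⟩L = R ∷ d ++ L ∷ []

R⟨⟩L-++ : ∀ d w → R⟨ d ⟩L ++ w ≡ R ∷ d ++ L ∷ w
R⟨⟩L-++ d w = cong (R ∷_) (++-assoc d (L ∷ []) w)

data Dyck : Word → Set where
  ε     : Dyck []
  ⟨_⟩∷_ : Dyck d → Dyck D → Dyck (R⟨ d ⟩L ++ D)

-- Descent h w: w = D₀ L D₁ L ⋯ L Dₕ with every Dᵢ a Dyck word.
data Descent : ℕ → Word → Set where
  flat : Dyck D → Descent 0 D
  step : Dyck D → Descent h w → Descent (suc h) (D ++ L ∷ w)

R⟨_⟩L∷_ : Dyck d → Descent h w → Descent h (R⟨ d ⟩L ++ w)
R⟨ pd ⟩L∷ flat pD = flat (⟨ pd ⟩∷ pD)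
R⟨_⟩L∷_ {d} pd (step {D} {w = w} pD δ) =
  subst (Descent _) (++-assoc R⟨ d ⟩L D (L ∷ w)) (step (⟨ pd ⟩∷ pD) δ)

path⇒descent : Path h w 0 → Descent h w
path⇒descent nil = flat ε
path⇒descent (up p) with path⇒descent p
... | step pD δ = subst (Descent _) (R⟨⟩L-++ _ _) (R⟨ pD ⟩L∷ δ)
path⇒descent (down p) = step ε (path⇒descent p)

path⇒dyck : Path 0 w 0 → Dyck w
path⇒dyck p with path⇒descent p
... | flat pw = pw

dyck⇒path : Dyck w → Path 0 w 0
dyck⇒path ε = nil
dyck⇒path (⟨ pd ⟩∷ pD) = path-++ (path-R⟨⟩L (dyck⇒path pd)) (dyck⇒path pD)

length-∷ʳ : ∀ (xs : Word) x → length (xs ∷ʳ x) ≡ suc (length xs)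
length-∷ʳ [] x = refl
length-∷ʳ (_ ∷ xs) x = cong suc (length-∷ʳ xs x)

dyck⇒upperPrime : Dyck d → UpperPrime R⟨ d ⟩L
dyck⇒upperPrime {d} pd = upperPrime (λ ()) (closed-path⇒balanced (path-R⟨⟩L path)) positive
  where
  path = dyck⇒path pd
  positive : PositivePrefixes R⟨ d ⟩L
  positive (suc k) _ k<|d|+1 =
    ℤP.suc[i]≤j⇒i<j (ℤP.suc-mono (subst (0ℤ ℤ.≤_) e-shift (path⇒e-nonneg path k)))
    where
    e-shift : 0ℤ ℤ.+ e k d ≡ e k (d ++ L ∷ [])
    e-shift = trans (ℤP.+-identityˡ (e k d))
      (sym (e-++ d (L ∷ []) (s≤s⁻¹ (subst (suc k ≤_) (length-∷ʳ d L) k<|d|+1))))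

positivePrefixes⇒tail-path : PositivePrefixes (R ∷ D ∷ʳ b) → Σ ℕ (Path 0 D)
positivePrefixes⇒tail-path {D} {b} pos = e-nonneg⇒path D 0 nonneg
  where
  0<suc⇒0≤ : ∀ {x} → 0ℤ ℤ.< ℤ.suc x → 0ℤ ℤ.≤ x
  0<suc⇒0≤ {x} 0<1+x = subst (0ℤ ℤ.≤_) (ℤP.pred-suc x) (ℤP.i<j⇒i≤pred[j] 0<1+x)
  nonneg : ∀ k → k ≤ length D → 0ℤ ℤ.≤ 0ℤ ℤ.+ e k D
  nonneg k k≤ = subst (0ℤ ℤ.≤_) e-shift (0<suc⇒0≤ (pos (suc k) (s≤s z≤n) k<|D|+1))
    where
    k<|D|+1 : suc k ≤ length (D ∷ʳ b)
    k<|D|+1 = subst (suc k ≤_) (sym (length-∷ʳ D b)) (s≤s k≤)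
    e-shift : e k (D ∷ʳ b) ≡ 0ℤ ℤ.+ e k D
    e-shift = trans (e-++ D (b ∷ []) k≤) (sym (ℤP.+-identityˡ (e k D)))

upperPrime-shape : ∀ a D b → Balanced (a ∷ D ∷ʳ b) → PositivePrefixes (a ∷ D ∷ʳ b) →
  Σ Word λ d → Dyck d × a ∷ D ∷ʳ b ≡ R⟨ d ⟩L
upperPrime-shape L D b _ pos
  with pos 1 (s≤s z≤n) (subst (1 ≤_) (sym (length-∷ʳ D b)) (s≤s z≤n))
... | ()
upperPrime-shape R D L bal pos with positivePrefixes⇒tail-path pos
... | h , p = D , path⇒dyck (subst (Path 0 D) (sym (path-balanced (path-R⟨⟩L p) bal)) p) ,
  refl
upperPrime-shape R D R bal pos with positivePrefixes⇒tail-path pos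
... | h , p with path-balanced (up (path-++ (path-lift p) (up nil))) bal
... | ()

¬balanced-letter : ∀ a → ¬ Balanced (a ∷ [])
¬balanced-letter L ()
¬balanced-letter R ()

upperPrime⇒R⟨dyck⟩L : ∀ {P} → UpperPrime P → Σ Word λ d → Dyck d × P ≡ R⟨ d ⟩L
upperPrime⇒R⟨dyck⟩L {[]} ((P≢[] , _) , _) = ⊥-elim (P≢[] refl)
upperPrime⇒R⟨dyck⟩L {a ∷ w} ((_ , bal , _) , pos) with initLast w
... | [] = ⊥-elim (¬balanced-letter a bal)
... | D ∷ʳ′ b = upperPrime-shape a D b bal pos

dyck-commutes-LR : Dyck d → Commutes d LR
dyck-commutes-LR ε = commutes-[] LR
dyck-commutes-LR (⟨_⟩∷_ {d} {D} pd pD) =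
  commutes-++ˡ {R⟨ d ⟩L} {LR} {D}
    (upperPrime-commutes-LR (dyck⇒upperPrime pd)) (dyck-commutes-LR pD)

mutual
  dyck-commutes : Dyck D → Dyck E → Commutes D E
  dyck-commutes ε pE = commutes-[] _
  dyck-commutes {E = E} (⟨_⟩∷_ {d} {D} pd pD) pE =
    commutes-++ˡ {R⟨ d ⟩L} {E} {D} (R⟨dyck⟩L-commutes pd pE) (dyck-commutes pD pE)

  R⟨dyck⟩L-commutes : Dyck d → Dyck E → Commutes R⟨ d ⟩L E
  R⟨dyck⟩L-commutes {d} pd ε = ≈ᴵ-sym (commutes-[] R⟨ d ⟩L)
  R⟨dyck⟩L-commutes {d} pd (⟨_⟩∷_ {f} {F} pf pF) =
    commutes-++ʳ {R⟨ d ⟩L} {R⟨ f ⟩L} {F}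
      (R⟨dyck⟩L-commutes-R⟨dyck⟩L pd pf) (R⟨dyck⟩L-commutes pd pF)

  R⟨dyck⟩L-commutes-R⟨dyck⟩L : Dyck d → Dyck f → Commutes R⟨ d ⟩L R⟨ f ⟩L
  R⟨dyck⟩L-commutes-R⟨dyck⟩L {d} {f} pd pf = begin
    R⟨ d ⟩L ++ R⟨ f ⟩L
      ≡⟨ R⟨⟩L-++ d R⟨ f ⟩L ⟩
    R ∷ d ++ LR ++ f ++ L ∷ []
      ≡⟨ cong (R ∷_) (++-assoc d LR (f ++ L ∷ [])) ⟨
    R ∷ (d ++ LR) ++ f ++ L ∷ []
      ≈⟨ ≈ᴵ-cong (R ∷ []) (f ++ L ∷ []) (dyck-commutes-LR pd) ⟩
    R ∷ LR ++ d ++ f ++ L ∷ []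
      ≡⟨ cong (λ w → R ∷ LR ++ w) (++-assoc d f (L ∷ [])) ⟨
    R ∷ LR ++ (d ++ f) ++ L ∷ []
      ≈⟨ ≈ᴵ-cong (R ∷ LR) (L ∷ []) (dyck-commutes pd pf) ⟩
    R ∷ LR ++ (f ++ d) ++ L ∷ []
      ≡⟨ cong (λ w → R ∷ LR ++ w) (++-assoc f d (L ∷ [])) ⟩
    R ∷ (LR ++ f) ++ d ++ L ∷ []
      ≈⟨ ≈ᴵ-cong (R ∷ []) (d ++ L ∷ []) (≈ᴵ-sym (dyck-commutes-LR pf)) ⟩
    R ∷ (f ++ LR) ++ d ++ L ∷ []
      ≡⟨ cong (R ∷_) (++-assoc f LR (d ++ L ∷ [])) ⟩
    R ∷ f ++ LR ++ d ++ L ∷ []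
      ≡⟨ R⟨⟩L-++ f R⟨ d ⟩L ⟨
    R⟨ f ⟩L ++ R⟨ d ⟩L
      ∎

lemma5p1 : (P Q : Word) → UpperPrime P → UpperPrime Q → InIdeal (comm P Q)
lemma5p1 P Q uP uQ with upperPrime⇒R⟨dyck⟩L uP | upperPrime⇒R⟨dyck⟩L uQ
... | d , pd , refl | f , pf , refl =
  let ts , comm∼ts = R⟨dyck⟩L-commutes-R⟨dyck⟩L pd pf in ts , ∼⇒≈ᴾ comm∼ts
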